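{- Let $f$ be a finite sequence of positive integers. Then the following are equivalent: (1) $f$ is the face vector of a flag complex; (2) $f$ is the $h$-vector of the independence complex of a clique-whiskered graph, i.e. of $\mathrm{Ind}(G^\pi)$ for some finite simple graph $G$ with at least one vertex and some clique vertex-partition $\pi$ of $G$; (3) $f$ is the $h$-vector of the independence complex of a fully-whiskered graph, i.e. of $\mathrm{Ind}(G^\tau)$ for some finite simple graph $G$ with at least one vertex and $\tau$ the trivial partition of its vertex set into singletons. Here an $h$-vector is identified with the sequence obtained by deleting its trailing zero entries.
   Context: $\mathrm{Ind}(H)$ is the independence complex of a graph $H$ (faces = independent sets). A flag complex is a simplicial complex equal to $\mathrm{Ind}(G)$ for some finite simple graph $G$ with at least one vertex (equivalently, its Stanley-Reisner ideal is generated by quadratic squarefree monomials). A clique vertex-partition of a graph $G=(V,E)$ is a set $\pi=\{W_1,\ldots,W_t\}$ of pairwise disjoint, possibly empty, cliques of $G$ whose union is $V$; $G^\pi$ is obtained from $G$ by adding new vertices $w_1,\ldots,w_t$ and edges $vw_i$ for all $v\in W_i$. The trivial partition is $\tau=\{\{v\}:v\in V\}$. For a $(d-1)$-dimensional complex, the face vector is $(f_{ -1},\ldots,f_{d-1})$ with $f_i$ the number of $i$-dimensional faces ($f_{ -1}=1$) and the $h$-vector is $(h_0,\dots,h_d)$ with $h_j=\sum_{i=0}^j(-1)^{j-i}\binom{d-i}{j-i}f_{i-1}$. -}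

module Defs where

open import Data.Bool using (Bool; true; false; _∧_; not; if_then_else_)
open import Data.Nat using (ℕ; zero; suc; _≡ᵇ_; _⊔_; _∸_; _<_)
open import Data.Nat.Combinatorics using (_C_)
open import Data.Integer using (ℤ; +_; -[1+_]) renaming (_+_ to _+ℤ_; _*_ to _*ℤ_; _^_ to _^ℤ_)
open import Data.Fin using (Fin; _≟_; splitAt)
open import Data.Fin.Subset using (Subset; ∣_∣; ⁅_⁆; _∩_; ⊥)
open import Data.Vec using (Vec; []; _∷_; lookup; tabulate)
open import Data.List using (List; []; _∷_; map; filter; length; foldr; upTo; allFin)
open import Data.Product using (Σ; _×_; ∃; ∃-syntax)
open import Data.Sum using (inj₁; inj₂)
open import Relation.Binary.PropositionalEquality using (_≡_; _≢_)
open import Relation.Nullary.Decidable using (⌊_⌋)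

Adj : ℕ → Set
Adj n = Fin n → Fin n → Bool

IsSimpleGraph : ∀ {n} → Adj n → Set
IsSimpleGraph {n} adj = (∀ (u v : Fin n) → adj u v ≡ adj v u) × (∀ (u : Fin n) → adj u u ≡ false)

subsets : ∀ n → List (Subset n)
subsets zero = [] ∷ []
subsets (suc n) = map (false ∷_) (subsets n) Data.List.++ map (true ∷_) (subsets n)

-- S is independent in the graph: no two (not necessarily distinct, adjacency is irreflexive) members adjacent
isIndependent : ∀ {n} → Adj n → Subset n → Bool
isIndependent {n} adj S =
  allB (λ u → allB (λ v → not (lookup S u ∧ lookup S v ∧ adj u v)) (allFin n)) (allFin n)
  where
  allB : ∀ {A : Set} → (A → Bool) → List A → Bool
  allB p xs = foldr (λ x b → p x ∧ b) true xs

faces : ∀ {n} → Adj n → List (Subset n)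
faces {n} adj = filter (λ S → isIndependent adj S Data.Bool.≟ true) (subsets n)

-- d = dim Ind(G) + 1 = maximal size of a face
dimPlus1 : ∀ {n} → Adj n → ℕ
dimPlus1 adj = foldr _⊔_ 0 (map ∣_∣ (faces adj))

-- number of faces with k vertices, i.e. f_{k-1}
numFaces : ∀ {n} → Adj n → ℕ → ℕ
numFaces adj k = length (filter (λ S → ∣ S ∣ Data.Nat.≟ k) (faces adj))

-- face vector (f_{-1}, ..., f_{d-1}) of Ind(G)
faceVector : ∀ {n} → Adj n → List ℕ
faceVector adj = map (numFaces adj) (upTo (suc (dimPlus1 adj)))

hEntry : ∀ {n} → Adj n → ℕ → ℤ
hEntry adj j = foldr _+ℤ_ (+ 0)
  (map (λ i → ((-[1+ 0 ]) ^ℤ (j ∸ i)) *ℤ (+ ((dimPlus1 adj ∸ i) C (j ∸ i))) *ℤ (+ numFaces adj i))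
       (upTo (suc j)))

hVector : ∀ {n} → Adj n → List ℤ
hVector adj = map (hEntry adj) (upTo (suc (dimPlus1 adj)))

stripZeros : List ℤ → List ℤ
stripZeros [] = []
stripZeros (x ∷ xs) with stripZeros xs
... | [] = if ⌊ x Data.Integer.≟ + 0 ⌋ then [] else x ∷ []
... | y ∷ ys = x ∷ y ∷ ys

IsClique : ∀ {n} → Adj n → Subset n → Set
IsClique {n} adj W = ∀ (u v : Fin n) → lookup W u ≡ true → lookup W v ≡ true → u ≢ v → adj u v ≡ true

-- a clique vertex-partition π = {W_1, ..., W_t}: pairwise disjoint (possibly empty) cliques covering V
IsCliqueVertexPartition : ∀ {n t} → Adj n → Vec (Subset n) t → Set
IsCliqueVertexPartition {n} {t} adj π =
  (∀ (i : Fin t) → IsClique adj (lookup π i)) ×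
  (∀ (i j : Fin t) → i ≢ j → lookup π i ∩ lookup π j ≡ ⊥) ×
  (∀ (v : Fin n) → ∃[ i ] lookup (lookup π i) v ≡ true)

-- G^π on vertex set Fin (n + t): old vertices first, then the new vertices w_1..w_t
whisker : ∀ {n t} → Adj n → Vec (Subset n) t → Adj (n Data.Nat.+ t)
whisker {n} adj π x y with splitAt n x | splitAt n y
... | inj₁ u | inj₁ v = adj u v
... | inj₁ u | inj₂ i = lookup (lookup π i) u
... | inj₂ i | inj₁ u = lookup (lookup π i) u
... | inj₂ i | inj₂ j = false

trivialPartition : ∀ n → Vec (Subset n) n
trivialPartition n = tabulate ⁅_⁆

IsFlagFaceVector : List ℕ → Set
IsFlagFaceVector f = ∃[ n ] Σ (Adj n) λ adj → (0 < n) × IsSimpleGraph adj × (faceVector adj ≡ f)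

IsCliqueWhiskeredHVector : List ℕ → Set
IsCliqueWhiskeredHVector f = ∃[ n ] Σ (Adj n) λ adj → ∃[ t ] Σ (Vec (Subset n) t) λ π →
  (0 < n) × IsSimpleGraph adj × IsCliqueVertexPartition adj π ×
  (stripZeros (hVector (whisker adj π)) ≡ map +_ f)

IsFullyWhiskeredHVector : List ℕ → Set
IsFullyWhiskeredHVector f = ∃[ n ] Σ (Adj n) λ adj →
  (0 < n) × IsSimpleGraph adj ×
  (stripZeros (hVector (whisker adj (trivialPartition n))) ≡ map +_ f)

module Submission where

-- Let G have n vertices and let π = (W₁,…,W_t) be a clique vertex-partition of G.  An independent
-- set of G^π is a pair (S, T) with S independent in G and T a set of whiskers w_i such that
-- W_i ∩ S = ∅.  Since each clique W_i meets an independent S in at most one vertex, and the W_i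
-- partition V, exactly t − |S| whiskers are free; hence
--     f_{i-1}(G^π) = Σ_{S ∈ Ind G} C(t − |S|, i − |S|)     and     dim Ind(G^π) + 1 = t.
-- Substituting into the definition of h_j and summing over i first, the binomial inversion
--     Σ_i (−1)^{j−i} C(t−i, j−i) C(t−s, i−s) = [s = j]      (s, j ≤ t)
-- gives h_j(G^π) = f_{j-1}(G) for all j ≤ t.  Since dim Ind G + 1 ≤ t and the top face number of
-- Ind G is positive, stripping trailing zeros from h(G^π) yields exactly the face vector of Ind G.
-- The theorem follows, because the trivial partition is a clique vertex-partition.

open import Defs
open import Data.Bool as Bool using (Bool; true; false; _∧_; _∨_; not; if_then_else_)
import Data.Bool.Properties as BoolP
open import Data.Empty as Empty using (⊥-elim)
open import Data.Fin as Fin using (Fin; splitAt; _↑ˡ_; _↑ʳ_)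
import Data.Fin.Properties as FinP
open import Data.Fin.Subset using (Subset; ∣_∣; ⁅_⁆; _∩_; ⊥; ⊤)
open import Data.Fin.Subset.Properties using (∣⊥∣≡0; ∣⊤∣≡n; ∣p∣≤∣x∷p∣; x∈⁅x⁆; x∈⁅y⁆⇒x≡y; x∈p∩q⁻; Empty-unique)
open import Data.Integer as ℤ using (ℤ; +_; -[1+_]; _+_; _*_; -_)
import Data.Integer.Properties as ℤP
import Data.Integer.Tactic.RingSolver as ℤSolver
open import Data.List as List using (List; []; _∷_; map; filter; length; foldr; upTo; allFin; applyUpTo)
import Data.List.Properties as ListP
open import Data.List.Membership.Propositional using (_∈_)
import Data.List.Membership.Propositional.Properties as ∈P
open import Data.List.Relation.Unary.All as All using (All)
open import Data.List.Relation.Unary.Any using (here; there)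
open import Data.Nat as ℕ using (ℕ; zero; suc; _∸_; _<_; _≤_; _⊔_; z≤n; s≤s; _≡ᵇ_; _!)
import Data.Nat.Properties as ℕP
open import Algebra.Properties.Semiring.Sum ℕP.+-*-semiring using (sum; sum-cong-≗; ∑-distrib-+; ∑-comm; *-distribˡ-sum)
import Data.Nat.Tactic.RingSolver as ℕSolver
open import Data.Nat.Combinatorics using (_C_; nCk+nC[k+1]≡[n+1]C[k+1]; k>n⇒nCk≡0; k![n∸k]!∣n!)
open import Data.Nat.Combinatorics.Specification using (nCk≡n!/k![n-k]!)
open import Data.Nat.DivMod using (m/n*n≡m)
open import Data.Product using (Σ; _×_; _,_; proj₁; proj₂; ∃)
open import Data.Sum using (_⊎_; inj₁; inj₂)
open import Data.Vec as Vec using (Vec; []; _∷_; lookup; tabulate; _++_)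
import Data.Vec.Properties as VecP
open import Function using (_∘_)
open import Function.Bundles using (_⇔_; mk⇔)
open import Relation.Binary.PropositionalEquality
open import Relation.Nullary using (Dec; does; yes; no)
open import Relation.Nullary.Decidable using (⌊_⌋; dec-false)


sumL : {A : Set} → List A → (A → ℤ) → ℤ
sumL []       f = + 0
sumL (x ∷ xs) f = f x + sumL xs f

syntax sumL xs (λ x → e) = ∑[ x ∈ xs ] e

sumUpTo : ℕ → (ℕ → ℤ) → ℤ
sumUpTo zero    f = + 0
sumUpTo (suc n) f = f 0 + sumUpTo n (f ∘ suc)

syntax sumUpTo n (λ i → e) = ∑[ i < n ] e

foldr-map≡sumL : {A : Set} (xs : List A) (f : A → ℤ) → foldr _+_ (+ 0) (map f xs) ≡ sumL xs f
foldr-map≡sumL []       f = refl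
foldr-map≡sumL (x ∷ xs) f = cong (λ s → f x + s) (foldr-map≡sumL xs f)

sumL-upTo : ∀ n (f : ℕ → ℤ) → sumL (upTo n) f ≡ sumUpTo n f
sumL-upTo n f = go n (λ i → i)
  where
  go : ∀ n (g : ℕ → ℕ) → sumL (applyUpTo g n) f ≡ sumUpTo n (f ∘ g)
  go zero    g = refl
  go (suc n) g = cong (λ s → f (g 0) + s) (go n (g ∘ suc))

sumL-cong : {A : Set} (xs : List A) {f g : A → ℤ} → (∀ x → f x ≡ g x) → sumL xs f ≡ sumL xs g
sumL-cong []       e = refl
sumL-cong (x ∷ xs) e = cong₂ _+_ (e x) (sumL-cong xs e)

sumL-++ : {A : Set} (xs ys : List A) (f : A → ℤ) → sumL (xs List.++ ys) f ≡ sumL xs f + sumL ys f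
sumL-++ []       ys f = sym (ℤP.+-identityˡ _)
sumL-++ (x ∷ xs) ys f = trans (cong (λ s → f x + s) (sumL-++ xs ys f)) (sym (ℤP.+-assoc (f x) _ _))

sumL-map : {A B : Set} (xs : List A) (h : A → B) (f : B → ℤ) → sumL (map h xs) f ≡ sumL xs (f ∘ h)
sumL-map []       h f = refl
sumL-map (x ∷ xs) h f = cong (λ s → f (h x) + s) (sumL-map xs h f)

sumL-zero : {A : Set} (xs : List A) {f : A → ℤ} → (∀ x → f x ≡ + 0) → sumL xs f ≡ + 0
sumL-zero []       e = refl
sumL-zero (x ∷ xs) e = cong₂ _+_ (e x) (sumL-zero xs e)

sumL-+ : {A : Set} (xs : List A) (f g : A → ℤ) → sumL xs (λ x → f x + g x) ≡ sumL xs f + sumL xs g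
sumL-+ []       f g = refl
sumL-+ (x ∷ xs) f g = trans (cong (λ s → f x + g x + s) (sumL-+ xs f g)) (interchange (f x) (g x) _ _)
  where
  interchange : ∀ a b c d → a + b + (c + d) ≡ a + c + (b + d)
  interchange = ℤSolver.solve-∀

sumL-*ˡ : {A : Set} (xs : List A) (c : ℤ) (f : A → ℤ) → sumL xs (λ x → c * f x) ≡ c * sumL xs f
sumL-*ˡ []       c f = sym (ℤP.*-zeroʳ c)
sumL-*ˡ (x ∷ xs) c f = trans (cong (λ s → c * f x + s) (sumL-*ˡ xs c f)) (sym (ℤP.*-distribˡ-+ c (f x) _))

sumL-swap : {A B : Set} (xs : List A) (ys : List B) (f : A → B → ℤ) →
  ∑[ x ∈ xs ] ∑[ y ∈ ys ] f x y ≡ ∑[ y ∈ ys ] ∑[ x ∈ xs ] f x y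
sumL-swap []       ys f = sym (sumL-zero ys (λ _ → refl))
sumL-swap (x ∷ xs) ys f =
  trans (cong (λ s → sumL ys (f x) + s) (sumL-swap xs ys f)) (sym (sumL-+ ys (f x) (λ y → ∑[ x ∈ xs ] f x y)))

sumUpTo-cong : ∀ n {f g : ℕ → ℤ} → (∀ i → i < n → f i ≡ g i) → sumUpTo n f ≡ sumUpTo n g
sumUpTo-cong zero    e = refl
sumUpTo-cong (suc n) e = cong₂ _+_ (e 0 (s≤s z≤n)) (sumUpTo-cong n (λ i i<n → e (suc i) (s≤s i<n)))

sumUpTo-zero : ∀ n {f : ℕ → ℤ} → (∀ i → i < n → f i ≡ + 0) → sumUpTo n f ≡ + 0
sumUpTo-zero n e = trans (sumUpTo-cong n e) (zeros n)
  where
  zeros : ∀ n → sumUpTo n (λ _ → + 0) ≡ + 0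
  zeros zero    = refl
  zeros (suc n) = trans (ℤP.+-identityˡ _) (zeros n)

sumUpTo-split : ∀ s k (f : ℕ → ℤ) → sumUpTo (s ℕ.+ k) f ≡ sumUpTo s f + ∑[ a < k ] f (s ℕ.+ a)
sumUpTo-split zero    k f = sym (ℤP.+-identityˡ _)
sumUpTo-split (suc s) k f = trans (cong (λ s → f 0 + s) (sumUpTo-split s k (f ∘ suc))) (sym (ℤP.+-assoc (f 0) _ _))

sumUpTo-last : ∀ n (f : ℕ → ℤ) → sumUpTo (suc n) f ≡ sumUpTo n f + f n
sumUpTo-last n f = begin
  sumUpTo (suc n) f                     ≡⟨ cong (λ m → sumUpTo m f) (ℕP.+-comm 1 n) ⟩
  sumUpTo (n ℕ.+ 1) f                   ≡⟨ sumUpTo-split n 1 f ⟩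
  sumUpTo n f + (f (n ℕ.+ 0) + + 0)     ≡⟨ cong (λ s → sumUpTo n f + s) (trans (ℤP.+-identityʳ _) (cong f (ℕP.+-identityʳ n))) ⟩
  sumUpTo n f + f n                     ∎
  where open ≡-Reasoning

sumUpTo-+ : ∀ n (f g : ℕ → ℤ) → ∑[ i < n ] (f i + g i) ≡ sumUpTo n f + sumUpTo n g
sumUpTo-+ zero    f g = refl
sumUpTo-+ (suc n) f g = trans (cong (λ s → f 0 + g 0 + s) (sumUpTo-+ n (f ∘ suc) (g ∘ suc))) (interchange (f 0) (g 0) _ _)
  where
  interchange : ∀ a b c d → a + b + (c + d) ≡ a + c + (b + d)
  interchange = ℤSolver.solve-∀

sumUpTo-*ˡ : ∀ n (c : ℤ) (f : ℕ → ℤ) → ∑[ i < n ] (c * f i) ≡ c * sumUpTo n f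
sumUpTo-*ˡ zero    c f = sym (ℤP.*-zeroʳ c)
sumUpTo-*ˡ (suc n) c f = trans (cong (λ s → c * f 0 + s) (sumUpTo-*ˡ n c (f ∘ suc))) (sym (ℤP.*-distribˡ-+ c (f 0) _))

sumUpTo-neg : ∀ n (f : ℕ → ℤ) → ∑[ i < n ] (- f i) ≡ - sumUpTo n f
sumUpTo-neg n f = begin
  ∑[ i < n ] (- f i)              ≡⟨ sumUpTo-cong n (λ i _ → sym (ℤP.-1*i≡-i (f i))) ⟩
  ∑[ i < n ] (-[1+ 0 ] * f i)     ≡⟨ sumUpTo-*ˡ n -[1+ 0 ] f ⟩
  -[1+ 0 ] * sumUpTo n f          ≡⟨ ℤP.-1*i≡-i _ ⟩
  - sumUpTo n f                   ∎
  where open ≡-Reasoning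

χ : Bool → ℤ
χ true  = + 1
χ false = + 0

χℕ : Bool → ℕ
χℕ true  = 1
χℕ false = 0

χ-∧ : ∀ a b → χ (a ∧ b) ≡ χ a * χ b
χ-∧ true  b = sym (ℤP.*-identityˡ (χ b))
χ-∧ false b = refl

χ-guard : ∀ b {x y : ℤ} → (b ≡ true → x ≡ y) → χ b * x ≡ χ b * y
χ-guard true  h = cong (+ 1 *_) (h refl)
χ-guard false {x} {y} h = trans (ℤP.*-zeroˡ x) (sym (ℤP.*-zeroˡ y))

length-filter≡sumL : {A : Set} {P : A → Set} (P? : ∀ x → Dec (P x)) (xs : List A) →
  + length (filter P? xs) ≡ ∑[ x ∈ xs ] χ (does (P? x))
length-filter≡sumL P? []       = refl
length-filter≡sumL P? (x ∷ xs) with does (P? x)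
... | false = trans (length-filter≡sumL P? xs) (sym (ℤP.+-identityˡ _))
... | true  = trans (ℤP.pos-+ 1 _) (cong (λ s → + 1 + s) (length-filter≡sumL P? xs))

sumL-filter : {A : Set} {P : A → Set} (P? : ∀ x → Dec (P x)) (xs : List A) (g : A → ℤ) →
  sumL (filter P? xs) g ≡ ∑[ x ∈ xs ] (χ (does (P? x)) * g x)
sumL-filter P? []       g = refl
sumL-filter P? (x ∷ xs) g with does (P? x)
... | false = trans (sumL-filter P? xs g) (sym (ℤP.+-identityˡ _))
... | true  = cong₂ _+_ (sym (ℤP.*-identityˡ (g x))) (sumL-filter P? xs g)

allB : {A : Set} → (A → Bool) → List A → Bool
allB p xs = foldr (λ x b → p x ∧ b) true xs

allB-sound : {A : Set} (p : A → Bool) (xs : List A) → allB p xs ≡ true → ∀ {x} → x ∈ xs → p x ≡ true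
allB-sound p (y ∷ xs) e (here refl) = BoolP.∧-conicalˡ (p y) _ e
allB-sound p (y ∷ xs) e (there x∈) = allB-sound p xs (BoolP.∧-conicalʳ (p y) _ e) x∈

allB-complete : {A : Set} (p : A → Bool) (xs : List A) → (∀ x → p x ≡ true) → allB p xs ≡ true
allB-complete p []       h = refl
allB-complete p (x ∷ xs) h rewrite h x = allB-complete p xs h

Independent : ∀ {n} → Adj n → Subset n → Set
Independent {n} adj S = ∀ (u v : Fin n) → lookup S u ≡ true → lookup S v ≡ true → adj u v ≡ false

isIndependent-sound : ∀ {n} (adj : Adj n) S → isIndependent adj S ≡ true → Independent adj S
isIndependent-sound {n} adj S e u v Su Sv =
  BoolP.not-injective (subst (λ b → not b ≡ true) (cong₂ (λ a b → a ∧ b ∧ adj u v) Su Sv) uv-ok)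
  where
  uv-ok : not (lookup S u ∧ lookup S v ∧ adj u v) ≡ true
  uv-ok = allB-sound _ (allFin n) (allB-sound _ (allFin n) e (∈P.∈-allFin u)) (∈P.∈-allFin v)

isIndependent-complete : ∀ {n} (adj : Adj n) S → Independent adj S → isIndependent adj S ≡ true
isIndependent-complete {n} adj S I =
  allB-complete _ (allFin n) (λ u → allB-complete _ (allFin n) (λ v → pair-ok _ _ _ (I u v)))
  where
  pair-ok : ∀ a b c → (a ≡ true → b ≡ true → c ≡ false) → not (a ∧ b ∧ c) ≡ true
  pair-ok true  true  c k rewrite k refl refl = refl
  pair-ok true  false c k = refl
  pair-ok false b     c k = refl

∣∷∣ : ∀ {m} b (S : Subset m) → ∣ b ∷ S ∣ ≡ χℕ b ℕ.+ ∣ S ∣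
∣∷∣ true  S = refl
∣∷∣ false S = refl

∣++∣ : ∀ {m k} (S : Subset m) (T : Subset k) → ∣ S ++ T ∣ ≡ ∣ S ∣ ℕ.+ ∣ T ∣
∣++∣ []      T = refl
∣++∣ (b ∷ S) T = begin
  ∣ b ∷ S ++ T ∣              ≡⟨ ∣∷∣ b (S ++ T) ⟩
  χℕ b ℕ.+ ∣ S ++ T ∣         ≡⟨ cong (χℕ b ℕ.+_) (∣++∣ S T) ⟩
  χℕ b ℕ.+ (∣ S ∣ ℕ.+ ∣ T ∣)  ≡⟨ sym (ℕP.+-assoc (χℕ b) _ _) ⟩
  χℕ b ℕ.+ ∣ S ∣ ℕ.+ ∣ T ∣    ≡⟨ cong (ℕ._+ ∣ T ∣) (sym (∣∷∣ b S)) ⟩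
  ∣ b ∷ S ∣ ℕ.+ ∣ T ∣         ∎
  where open ≡-Reasoning

∈-subsets : ∀ {m} (S : Subset m) → S ∈ subsets m
∈-subsets []                = here refl
∈-subsets {suc m} (false ∷ S) = ∈P.∈-++⁺ˡ (∈P.∈-map⁺ (false ∷_) (∈-subsets S))
∈-subsets {suc m} (true ∷ S)  = ∈P.∈-++⁺ʳ (map (false ∷_) (subsets m)) (∈P.∈-map⁺ (true ∷_) (∈-subsets S))

sum-subsets-suc : ∀ n (g : Subset (suc n) → ℤ) →
  sumL (subsets (suc n)) g ≡ ∑[ S ∈ subsets n ] g (false ∷ S) + ∑[ S ∈ subsets n ] g (true ∷ S)
sum-subsets-suc n g = trans (sumL-++ (map (false ∷_) (subsets n)) _ g)
  (cong₂ _+_ (sumL-map (subsets n) (false ∷_) g) (sumL-map (subsets n) (true ∷_) g))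

sum-subsets-++ : ∀ n t (g : Subset (n ℕ.+ t) → ℤ) →
  sumL (subsets (n ℕ.+ t)) g ≡ ∑[ S ∈ subsets n ] ∑[ T ∈ subsets t ] g (S ++ T)
sum-subsets-++ zero    t g = sym (ℤP.+-identityʳ _)
sum-subsets-++ (suc n) t g = begin
  sumL (subsets (suc n ℕ.+ t)) g
    ≡⟨ sum-subsets-suc (n ℕ.+ t) g ⟩
  sumL (subsets (n ℕ.+ t)) (g ∘ (false ∷_)) + sumL (subsets (n ℕ.+ t)) (g ∘ (true ∷_))
    ≡⟨ cong₂ _+_ (sum-subsets-++ n t (g ∘ (false ∷_))) (sum-subsets-++ n t (g ∘ (true ∷_))) ⟩
  ∑[ S ∈ subsets n ] ∑[ T ∈ subsets t ] g (false ∷ S ++ T) + ∑[ S ∈ subsets n ] ∑[ T ∈ subsets t ] g (true ∷ S ++ T)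
    ≡⟨ sym (sum-subsets-suc n (λ S → ∑[ T ∈ subsets t ] g (S ++ T))) ⟩
  ∑[ S ∈ subsets (suc n) ] ∑[ T ∈ subsets t ] g (S ++ T)
    ∎
  where open ≡-Reasoning

numFaces≡sum : ∀ {n} (adj : Adj n) k →
  + numFaces adj k ≡ ∑[ S ∈ subsets n ] (χ (isIndependent adj S) * χ (∣ S ∣ ≡ᵇ k))
numFaces≡sum {n} adj k =
  trans (length-filter≡sumL (λ S → ∣ S ∣ ℕ.≟ k) (faces adj))
    (trans (sumL-filter (λ S → isIndependent adj S Bool.≟ true) (subsets n) _)
      (sumL-cong (subsets n) (λ S → cong (λ b → χ b * χ (∣ S ∣ ≡ᵇ k)) (does-≟true (isIndependent adj S)))))
  where
  does-≟true : ∀ b → does (b Bool.≟ true) ≡ b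
  does-≟true true  = refl
  does-≟true false = refl

_⊆ᵇ_ : ∀ {m} → Subset m → Subset m → Bool
[]      ⊆ᵇ []      = true
(a ∷ T) ⊆ᵇ (b ∷ F) = (not a ∨ b) ∧ (T ⊆ᵇ F)

⊆ᵇ-sound : ∀ {m} (T F : Subset m) → T ⊆ᵇ F ≡ true → ∀ i → lookup T i ≡ true → lookup F i ≡ true
⊆ᵇ-sound (true ∷ T) (true ∷ F) e Fin.zero    Ti = refl
⊆ᵇ-sound (a ∷ T)    (b ∷ F)    e (Fin.suc i) Ti = ⊆ᵇ-sound T F (BoolP.∧-conicalʳ (not a ∨ b) _ e) i Ti

⊆ᵇ-complete : ∀ {m} (T F : Subset m) → (∀ i → lookup T i ≡ true → lookup F i ≡ true) → T ⊆ᵇ F ≡ true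
⊆ᵇ-complete []          []      h = refl
⊆ᵇ-complete (false ∷ T) (b ∷ F) h = ⊆ᵇ-complete T F (h ∘ Fin.suc)
⊆ᵇ-complete (true ∷ T)  (b ∷ F) h rewrite h Fin.zero refl = ⊆ᵇ-complete T F (h ∘ Fin.suc)

⊆ᵇ-∣∣-mono : ∀ {m} (T F : Subset m) → T ⊆ᵇ F ≡ true → ∣ T ∣ ≤ ∣ F ∣
⊆ᵇ-∣∣-mono []          []          e = z≤n
⊆ᵇ-∣∣-mono (false ∷ T) (false ∷ F) e = ⊆ᵇ-∣∣-mono T F e
⊆ᵇ-∣∣-mono (false ∷ T) (true ∷ F)  e = ℕP.m≤n⇒m≤1+n (⊆ᵇ-∣∣-mono T F e)
⊆ᵇ-∣∣-mono (true ∷ T)  (true ∷ F)  e = s≤s (⊆ᵇ-∣∣-mono T F e)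

count-subsets : ∀ {t} (F : Subset t) k → ∑[ T ∈ subsets t ] (χ (T ⊆ᵇ F) * χ (∣ T ∣ ≡ᵇ k)) ≡ + (∣ F ∣ C k)
count-subsets []          zero    = refl
count-subsets []          (suc k) = refl
count-subsets {suc t} (false ∷ F) k = begin
  _  ≡⟨ sum-subsets-suc t _ ⟩
  _  ≡⟨ cong₂ _+_ (count-subsets F k) (sumL-zero (subsets t) (λ T → refl)) ⟩
  _  ≡⟨ ℤP.+-identityʳ _ ⟩
  _  ∎
  where open ≡-Reasoning
count-subsets {suc t} (true ∷ F) zero = begin
  _  ≡⟨ sum-subsets-suc t _ ⟩
  _  ≡⟨ cong₂ _+_ (count-subsets F zero) (sumL-zero (subsets t) (λ T → ℤP.*-zeroʳ (χ (T ⊆ᵇ F)))) ⟩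
  _  ≡⟨ ℤP.+-identityʳ _ ⟩
  _  ∎
  where open ≡-Reasoning
count-subsets {suc t} (true ∷ F) (suc k) = begin
  _                                ≡⟨ sum-subsets-suc t _ ⟩
  _                                ≡⟨ cong₂ _+_ (count-subsets F (suc k)) (count-subsets F k) ⟩
  + (∣ F ∣ C suc k) + + (∣ F ∣ C k) ≡⟨ ℤP.pos-+ (∣ F ∣ C suc k) (∣ F ∣ C k) ⟩
  + (∣ F ∣ C suc k ℕ.+ ∣ F ∣ C k)   ≡⟨ cong +_ (ℕP.+-comm (∣ F ∣ C suc k) _) ⟩
  + (∣ F ∣ C k ℕ.+ ∣ F ∣ C suc k)   ≡⟨ cong +_ (nCk+nC[k+1]≡[n+1]C[k+1] ∣ F ∣ k) ⟩
  + (suc ∣ F ∣ C suc k)             ∎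
  where open ≡-Reasoning

-- C(m, i − s) when s ≤ i, and 0 otherwise.
shiftedC : ℕ → ℕ → ℕ → ℕ
shiftedC m zero    i       = m C i
shiftedC m (suc s) zero    = 0
shiftedC m (suc s) (suc i) = shiftedC m s i

shiftedC-+ : ∀ m s a → shiftedC m s (s ℕ.+ a) ≡ m C a
shiftedC-+ m zero    a = refl
shiftedC-+ m (suc s) a = shiftedC-+ m s a

shiftedC-< : ∀ m s i → i < s → shiftedC m s i ≡ 0
shiftedC-< m (suc s) zero    i<s       = refl
shiftedC-< m (suc s) (suc i) (s≤s i<s) = shiftedC-< m s i i<s

count-subsets-shifted : ∀ {t} (F : Subset t) s i →
  ∑[ T ∈ subsets t ] (χ (T ⊆ᵇ F) * χ (s ℕ.+ ∣ T ∣ ≡ᵇ i)) ≡ + shiftedC ∣ F ∣ s i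
count-subsets-shifted F zero    i       = count-subsets F i
count-subsets-shifted F (suc s) zero    = sumL-zero (subsets _) (λ T → ℤP.*-zeroʳ (χ (T ⊆ᵇ F)))
count-subsets-shifted F (suc s) (suc i) = count-subsets-shifted F s i

∣tabulate∣ : ∀ {m} (g : Fin m → Bool) → ∣ tabulate g ∣ ≡ sum (χℕ ∘ g)
∣tabulate∣ {zero}  g = refl
∣tabulate∣ {suc m} g = trans (∣∷∣ (g Fin.zero) (tabulate (g ∘ Fin.suc))) (cong (χℕ (g Fin.zero) ℕ.+_) (∣tabulate∣ (g ∘ Fin.suc)))

∣∣≡sum : ∀ {m} (p : Subset m) → ∣ p ∣ ≡ sum (χℕ ∘ lookup p)
∣∣≡sum p = trans (cong ∣_∣ (sym (VecP.tabulate∘lookup p))) (∣tabulate∣ (lookup p))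

∣∣≡0⇒empty : ∀ {m} (p : Subset m) → ∣ p ∣ ≡ 0 → ∀ u → lookup p u ≡ false
∣∣≡0⇒empty (false ∷ p) e Fin.zero    = refl
∣∣≡0⇒empty (false ∷ p) e (Fin.suc u) = ∣∣≡0⇒empty p e u

empty⇒∣∣≡0 : ∀ {m} (p : Subset m) → (∀ u → lookup p u ≡ false) → ∣ p ∣ ≡ 0
empty⇒∣∣≡0 []      h = refl
empty⇒∣∣≡0 (b ∷ p) h rewrite h Fin.zero = empty⇒∣∣≡0 p (h ∘ Fin.suc)

AtMostOne : ∀ {m} → Subset m → Set
AtMostOne {m} p = ∀ (u v : Fin m) → lookup p u ≡ true → lookup p v ≡ true → u ≡ v

atMostOne⇒∣∣≤1 : ∀ {m} (p : Subset m) → AtMostOne p → ∣ p ∣ ≤ 1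
atMostOne⇒∣∣≤1 []          h = z≤n
atMostOne⇒∣∣≤1 (false ∷ p) h = atMostOne⇒∣∣≤1 p (λ u v pu pv → FinP.suc-injective (h (Fin.suc u) (Fin.suc v) pu pv))
atMostOne⇒∣∣≤1 (true ∷ p)  h = s≤s (ℕP.≤-reflexive (empty⇒∣∣≡0 p rest-empty))
  where
  rest-empty : ∀ v → lookup p v ≡ false
  rest-empty v = BoolP.¬-not (λ pv → case-zero≢suc (h Fin.zero (Fin.suc v) refl pv))
    where
    case-zero≢suc : Fin.zero ≡ Fin.suc v → Empty.⊥
    case-zero≢suc ()

nonempty⇒1≤∣∣ : ∀ {m} (p : Subset m) u → lookup p u ≡ true → 1 ≤ ∣ p ∣
nonempty⇒1≤∣∣ (true ∷ p) Fin.zero    pu = s≤s z≤n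
nonempty⇒1≤∣∣ (b ∷ p)    (Fin.suc u) pu = ℕP.≤-trans (nonempty⇒1≤∣∣ p u pu) (∣p∣≤∣x∷p∣ b p)

empty-indicator+size : ∀ {m} → m ≤ 1 → χℕ (m ≡ᵇ 0) ℕ.+ m ≡ 1
empty-indicator+size z≤n       = refl
empty-indicator+size (s≤s z≤n) = refl

-- The largest face.  dimPlus1 is the maximum of the face sizes; it bounds every face and is
-- attained (by the empty face when the maximum is 0).

foldr-⊔-ub : ∀ {x} xs → x ∈ xs → x ≤ foldr _⊔_ 0 xs
foldr-⊔-ub (y ∷ xs) (here refl) = ℕP.m≤m⊔n y _
foldr-⊔-ub (y ∷ xs) (there x∈) = ℕP.≤-trans (foldr-⊔-ub xs x∈) (ℕP.m≤n⊔m y _)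

foldr-⊔-attained : ∀ xs → foldr _⊔_ 0 xs ≡ 0 ⊎ foldr _⊔_ 0 xs ∈ xs
foldr-⊔-attained []       = inj₁ refl
foldr-⊔-attained (y ∷ xs) with ℕP.⊔-sel y (foldr _⊔_ 0 xs)
... | inj₁ e = inj₂ (here e)
... | inj₂ e with foldr-⊔-attained xs
...   | inj₁ e₀ = inj₁ (trans e e₀)
...   | inj₂ m  = inj₂ (subst (_∈ y ∷ xs) (sym e) (there m))

∈-faces : ∀ {n} (adj : Adj n) S → isIndependent adj S ≡ true → S ∈ faces adj
∈-faces adj S e = ∈P.∈-filter⁺ (λ S → isIndependent adj S Bool.≟ true) (∈-subsets S) e

∅-independent : ∀ {n} (adj : Adj n) → isIndependent adj ⊥ ≡ true
∅-independent {n} adj = isIndependent-complete adj ⊥ (λ u v ∅u _ → ⊥-elim (false≢true ∅u))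
  where
  false≢true : ∀ {u : Fin n} → lookup ⊥ u ≡ true → Empty.⊥
  false≢true {u} e with trans (sym (VecP.lookup-replicate u false)) e
  ... | ()

face-size≤dim : ∀ {n} (adj : Adj n) S → isIndependent adj S ≡ true → ∣ S ∣ ≤ dimPlus1 adj
face-size≤dim adj S e = foldr-⊔-ub (map ∣_∣ (faces adj)) (∈P.∈-map⁺ ∣_∣ (∈-faces adj S e))

largest-face : ∀ {n} (adj : Adj n) → ∃ λ S → (isIndependent adj S ≡ true) × (∣ S ∣ ≡ dimPlus1 adj)
largest-face {n} adj with foldr-⊔-attained (map ∣_∣ (faces adj))
... | inj₁ e = ⊥ , ∅-independent adj , trans (∣⊥∣≡0 n) (sym e)
... | inj₂ m with ∈P.∈-map⁻ ∣_∣ m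
...   | S , S∈ , e = S , proj₂ (∈P.∈-filter⁻ (λ S → isIndependent adj S Bool.≟ true) {xs = subsets n} S∈) , sym e

numFaces-above-dim : ∀ {n} (adj : Adj n) k → dimPlus1 adj < k → numFaces adj k ≡ 0
numFaces-above-dim {n} adj k dim<k = cong length (ListP.filter-none (λ S → ∣ S ∣ ℕ.≟ k) (All.tabulate too-large))
  where
  too-large : ∀ {S} → S ∈ faces adj → ∣ S ∣ ≢ k
  too-large {S} S∈ refl = ℕP.<⇒≱ dim<k (face-size≤dim adj S
    (proj₂ (∈P.∈-filter⁻ (λ S → isIndependent adj S Bool.≟ true) {xs = subsets n} S∈)))

numFaces-top≢0 : ∀ {n} (adj : Adj n) → numFaces adj (dimPlus1 adj) ≢ 0
numFaces-top≢0 adj with largest-face adj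
... | S , S-ind , S-size = nonempty (∈P.∈-filter⁺ (λ S → ∣ S ∣ ℕ.≟ dimPlus1 adj) (∈-faces adj S S-ind) S-size)
  where
  nonempty : ∀ {A : Set} {x : A} {xs} → x ∈ xs → length xs ≢ 0
  nonempty (here _)  ()
  nonempty (there _) ()

disjointᵇ : ∀ {m} → Subset m → Subset m → Bool
disjointᵇ S W = ∣ S ∩ W ∣ ≡ᵇ 0

disjointᵇ-sound : ∀ {m} (S W : Subset m) → disjointᵇ S W ≡ true →
  ∀ u → lookup S u ≡ true → lookup W u ≡ false
disjointᵇ-sound S W e u Su = begin
  lookup W u                 ≡⟨ cong (_∧ lookup W u) (sym Su) ⟩
  lookup S u ∧ lookup W u    ≡⟨ sym (VecP.lookup-zipWith _∧_ u S W) ⟩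
  lookup (S ∩ W) u           ≡⟨ ∣∣≡0⇒empty (S ∩ W) (≡ᵇ0-sound ∣ S ∩ W ∣ e) u ⟩
  false                      ∎
  where
  open ≡-Reasoning
  ≡ᵇ0-sound : ∀ k → (k ≡ᵇ 0) ≡ true → k ≡ 0
  ≡ᵇ0-sound zero e = refl

disjointᵇ-complete : ∀ {m} (S W : Subset m) → (∀ u → lookup S u ≡ true → lookup W u ≡ false) →
  disjointᵇ S W ≡ true
disjointᵇ-complete S W h = cong (_≡ᵇ 0) (empty⇒∣∣≡0 (S ∩ W) meet-empty)
  where
  meet-empty : ∀ u → lookup (S ∩ W) u ≡ false
  meet-empty u with lookup S u in Su
  ... | false = trans (VecP.lookup-zipWith _∧_ u S W) (cong (_∧ lookup W u) Su)
  ... | true  = trans (VecP.lookup-zipWith _∧_ u S W) (cong₂ _∧_ Su (h u Su))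

Bool-ext : ∀ {a b} → (a ≡ true → b ≡ true) → (b ≡ true → a ≡ true) → a ≡ b
Bool-ext {false} {false} f g = refl
Bool-ext {false} {true}  f g = g refl
Bool-ext {true}  {false} f g = sym (f refl)
Bool-ext {true}  {true}  f g = refl

module Whiskered {n t : ℕ} (adj : Adj n) (π : Vec (Subset n) t) where

  Gπ : Adj (n ℕ.+ t)
  Gπ = whisker adj π

  old-old : ∀ u v → Gπ (u ↑ˡ t) (v ↑ˡ t) ≡ adj u v
  old-old u v rewrite FinP.splitAt-↑ˡ n u t | FinP.splitAt-↑ˡ n v t = refl

  old-new : ∀ u i → Gπ (u ↑ˡ t) (n ↑ʳ i) ≡ lookup (lookup π i) u
  old-new u i rewrite FinP.splitAt-↑ˡ n u t | FinP.splitAt-↑ʳ n t i = refl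

  new-old : ∀ i u → Gπ (n ↑ʳ i) (u ↑ˡ t) ≡ lookup (lookup π i) u
  new-old i u rewrite FinP.splitAt-↑ˡ n u t | FinP.splitAt-↑ʳ n t i = refl

  new-new : ∀ i j → Gπ (n ↑ʳ i) (n ↑ʳ j) ≡ false
  new-new i j rewrite FinP.splitAt-↑ʳ n t i | FinP.splitAt-↑ʳ n t j = refl

  old-or-new : ∀ (x : Fin (n ℕ.+ t)) → (∃ λ u → x ≡ u ↑ˡ t) ⊎ (∃ λ i → x ≡ n ↑ʳ i)
  old-or-new x with splitAt n x in e
  ... | inj₁ u = inj₁ (u , sym (FinP.splitAt⁻¹-↑ˡ e))
  ... | inj₂ i = inj₂ (i , sym (FinP.splitAt⁻¹-↑ʳ e))

  free : Subset n → Subset t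
  free S = tabulate (λ i → disjointᵇ S (lookup π i))

  free-sound : ∀ S i → lookup (free S) i ≡ true → ∀ u → lookup S u ≡ true → lookup (lookup π i) u ≡ false
  free-sound S i e = disjointᵇ-sound S (lookup π i) (trans (sym (VecP.lookup∘tabulate _ i)) e)

  free-complete : ∀ S i → (∀ u → lookup S u ≡ true → lookup (lookup π i) u ≡ false) → lookup (free S) i ≡ true
  free-complete S i h = trans (VecP.lookup∘tabulate _ i) (disjointᵇ-complete S (lookup π i) h)

  independent-++⇒ : ∀ S T → Independent Gπ (S ++ T) →
    Independent adj S × (∀ i → lookup T i ≡ true → lookup (free S) i ≡ true)
  independent-++⇒ S T I = S-independent , T-free
    where
    old : ∀ u → lookup S u ≡ true → lookup (S ++ T) (u ↑ˡ t) ≡ true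
    old u Su = trans (VecP.lookup-++ˡ S T u) Su
    S-independent : Independent adj S
    S-independent u v Su Sv = trans (sym (old-old u v)) (I _ _ (old u Su) (old v Sv))
    T-free : ∀ i → lookup T i ≡ true → lookup (free S) i ≡ true
    T-free i Ti = free-complete S i (λ u Su →
      trans (sym (old-new u i)) (I _ _ (old u Su) (trans (VecP.lookup-++ʳ S T i) Ti)))

  in-S : ∀ (S : Subset n) (T : Subset t) u → lookup (S ++ T) (u ↑ˡ t) ≡ true → lookup S u ≡ true
  in-S S T u e = trans (sym (VecP.lookup-++ˡ S T u)) e

  in-T : ∀ (S : Subset n) (T : Subset t) i → lookup (S ++ T) (n ↑ʳ i) ≡ true → lookup T i ≡ true
  in-T S T i e = trans (sym (VecP.lookup-++ʳ S T i)) e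

  independent-++⇐ : ∀ S T → Independent adj S → (∀ i → lookup T i ≡ true → lookup (free S) i ≡ true) →
    Independent Gπ (S ++ T)
  independent-++⇐ S T IS TF x y Sx Sy with old-or-new x | old-or-new y
  ... | inj₁ (u , refl) | inj₁ (v , refl) = trans (old-old u v) (IS u v (in-S S T u Sx) (in-S S T v Sy))
  ... | inj₁ (u , refl) | inj₂ (i , refl) = trans (old-new u i) (free-sound S i (TF i (in-T S T i Sy)) u (in-S S T u Sx))
  ... | inj₂ (i , refl) | inj₁ (u , refl) = trans (new-old i u) (free-sound S i (TF i (in-T S T i Sx)) u (in-S S T u Sy))
  ... | inj₂ (i , refl) | inj₂ (j , refl) = new-new i j

  independent-++ : ∀ S T → isIndependent Gπ (S ++ T) ≡ isIndependent adj S ∧ (T ⊆ᵇ free S)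
  independent-++ S T = Bool-ext to from
    where
    to : isIndependent Gπ (S ++ T) ≡ true → isIndependent adj S ∧ (T ⊆ᵇ free S) ≡ true
    to e with independent-++⇒ S T (isIndependent-sound Gπ (S ++ T) e)
    ... | IS , TF rewrite isIndependent-complete adj S IS = ⊆ᵇ-complete T (free S) TF
    from : isIndependent adj S ∧ (T ⊆ᵇ free S) ≡ true → isIndependent Gπ (S ++ T) ≡ true
    from e = isIndependent-complete Gπ (S ++ T) (independent-++⇐ S T
      (isIndependent-sound adj S (BoolP.∧-conicalˡ _ _ e))
      (⊆ᵇ-sound T (free S) (BoolP.∧-conicalʳ (isIndependent adj S) _ e)))

χℕ-∧ : ∀ a b → χℕ (a ∧ b) ≡ χℕ a ℕ.* χℕ b
χℕ-∧ true  b = sym (ℕP.+-identityʳ (χℕ b))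
χℕ-∧ false b = refl

sum-ones : ∀ m → sum {m} (λ _ → 1) ≡ m
sum-ones zero    = refl
sum-ones (suc m) = cong suc (sum-ones m)

-- For a clique vertex-partition π, an independent set S of G leaves exactly t − |S| whiskers free:
-- each vertex of S lies in exactly one part W_i, and each clique W_i meets S at most once, so
-- |S| = Σᵢ |S ∩ W_i| = Σᵢ (1 − [W_i ∩ S = ∅]) = t − |free S|.
module CliquePartition {n t : ℕ} (adj : Adj n) (π : Vec (Subset n) t) (cp : IsCliqueVertexPartition adj π) where
  open Whiskered adj π

  W : Fin t → Subset n
  W i = lookup π i

  parts∋ : Fin n → Subset t
  parts∋ u = tabulate (λ i → lookup (W i) u)

  ∣parts∋∣≡1 : ∀ u → ∣ parts∋ u ∣ ≡ 1
  ∣parts∋∣≡1 u = ℕP.≤-antisym (atMostOne⇒∣∣≤1 (parts∋ u) at-most-one)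
    (nonempty⇒1≤∣∣ (parts∋ u) i (trans (VecP.lookup∘tabulate _ i) u∈Wᵢ))
    where
    i : Fin t
    i = proj₁ (proj₂ (proj₂ cp) u)
    u∈Wᵢ : lookup (W i) u ≡ true
    u∈Wᵢ = proj₂ (proj₂ (proj₂ cp) u)
    at-most-one : AtMostOne (parts∋ u)
    at-most-one i j ei ej with i FinP.≟ j
    ... | yes i≡j = i≡j
    ... | no  i≢j = ⊥-elim (BoolP.not-¬ {true} refl (begin
          true                          ≡⟨ sym (cong₂ _∧_ (trans (sym (VecP.lookup∘tabulate _ i)) ei)
                                                           (trans (sym (VecP.lookup∘tabulate _ j)) ej)) ⟩
          lookup (W i) u ∧ lookup (W j) u ≡⟨ sym (VecP.lookup-zipWith _∧_ u (W i) (W j)) ⟩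
          lookup (W i ∩ W j) u            ≡⟨ cong (λ p → lookup p u) (proj₁ (proj₂ cp) i j i≢j) ⟩
          lookup ⊥ u                      ≡⟨ VecP.lookup-replicate u false ⟩
          false                           ∎))
      where open ≡-Reasoning

  ∣S∩W∣≤1 : ∀ S → Independent adj S → ∀ i → ∣ S ∩ W i ∣ ≤ 1
  ∣S∩W∣≤1 S I i = atMostOne⇒∣∣≤1 (S ∩ W i) at-most-one
    where
    both : ∀ {u} → lookup (S ∩ W i) u ≡ true → (lookup S u ≡ true) × (lookup (W i) u ≡ true)
    both {u} e = let e′ = trans (sym (VecP.lookup-zipWith _∧_ u S (W i))) e
                 in BoolP.∧-conicalˡ _ _ e′ , BoolP.∧-conicalʳ (lookup S u) _ e′
    at-most-one : AtMostOne (S ∩ W i)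
    at-most-one u v eu ev with u FinP.≟ v
    ... | yes u≡v = u≡v
    ... | no  u≢v = ⊥-elim (BoolP.not-¬ {true} refl (trans
            (sym (proj₁ cp i u v (proj₂ (both eu)) (proj₂ (both ev)) u≢v))
            (I u v (proj₁ (both eu)) (proj₁ (both ev)))))

  ∣S∣≡∑∣S∩W∣ : ∀ S → ∣ S ∣ ≡ sum (λ i → ∣ S ∩ W i ∣)
  ∣S∣≡∑∣S∩W∣ S = begin
    ∣ S ∣                                                    ≡⟨ ∣∣≡sum S ⟩
    sum (λ u → χℕ (lookup S u))                              ≡⟨ sum-cong-≗ (λ u → sym (ℕP.*-identityʳ (χℕ (lookup S u)))) ⟩
    sum (λ u → χℕ (lookup S u) ℕ.* 1)                        ≡⟨ sum-cong-≗ (λ u → cong (χℕ (lookup S u) ℕ.*_) (sym (trans (sym (∣tabulate∣ (λ i → lookup (W i) u))) (∣parts∋∣≡1 u)))) ⟩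
    sum (λ u → χℕ (lookup S u) ℕ.* sum (λ i → χℕ (lookup (W i) u)))
                                                             ≡⟨ sum-cong-≗ (λ u → *-distribˡ-sum (χℕ (lookup S u)) (λ i → χℕ (lookup (W i) u))) ⟩
    sum (λ u → sum (λ i → χℕ (lookup S u) ℕ.* χℕ (lookup (W i) u)))
                                                             ≡⟨ ∑-comm (λ u i → χℕ (lookup S u) ℕ.* χℕ (lookup (W i) u)) ⟩
    sum (λ i → sum (λ u → χℕ (lookup S u) ℕ.* χℕ (lookup (W i) u)))
                                                             ≡⟨ sum-cong-≗ (λ i → sum-cong-≗ (λ u → meet u i)) ⟩
    sum (λ i → sum (λ u → χℕ (lookup (S ∩ W i) u)))         ≡⟨ sum-cong-≗ (λ i → sym (∣∣≡sum (S ∩ W i))) ⟩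
    sum (λ i → ∣ S ∩ W i ∣)                                  ∎
    where
    open ≡-Reasoning
    meet : ∀ u i → χℕ (lookup S u) ℕ.* χℕ (lookup (W i) u) ≡ χℕ (lookup (S ∩ W i) u)
    meet u i = trans (sym (χℕ-∧ (lookup S u) (lookup (W i) u))) (cong χℕ (sym (VecP.lookup-zipWith _∧_ u S (W i))))

  free-size : ∀ S → Independent adj S → ∣ free S ∣ ℕ.+ ∣ S ∣ ≡ t
  free-size S I = begin
    ∣ free S ∣ ℕ.+ ∣ S ∣                                       ≡⟨ cong₂ ℕ._+_ (∣tabulate∣ (λ i → disjointᵇ S (W i))) (∣S∣≡∑∣S∩W∣ S) ⟩
    sum (λ i → χℕ (disjointᵇ S (W i))) ℕ.+ sum (λ i → ∣ S ∩ W i ∣) ≡⟨ sym (∑-distrib-+ (λ i → χℕ (disjointᵇ S (W i))) (λ i → ∣ S ∩ W i ∣)) ⟩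
    sum (λ i → χℕ (disjointᵇ S (W i)) ℕ.+ ∣ S ∩ W i ∣)         ≡⟨ sum-cong-≗ (λ i → empty-indicator+size (∣S∩W∣≤1 S I i)) ⟩
    sum (λ (_ : Fin t) → 1)                                   ≡⟨ sum-ones t ⟩
    t                                                         ∎
    where open ≡-Reasoning

  free-size′ : ∀ S → Independent adj S → ∣ free S ∣ ≡ t ∸ ∣ S ∣
  free-size′ S I = trans (sym (ℕP.m+n∸n≡m ∣ free S ∣ ∣ S ∣)) (cong (_∸ ∣ S ∣) (free-size S I))

  faces-over : ∀ S i →
    ∑[ T ∈ subsets t ] (χ (isIndependent Gπ (S ++ T)) * χ (∣ S ++ T ∣ ≡ᵇ i))
      ≡ χ (isIndependent adj S) * + shiftedC (t ∸ ∣ S ∣) ∣ S ∣ i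
  faces-over S i = begin
    (∑[ T ∈ subsets t ] (χ (isIndependent Gπ (S ++ T)) * χ (∣ S ++ T ∣ ≡ᵇ i)))
      ≡⟨ sumL-cong (subsets t) split ⟩
    (∑[ T ∈ subsets t ] (χ (isIndependent adj S) * (χ (T ⊆ᵇ free S) * χ (∣ S ∣ ℕ.+ ∣ T ∣ ≡ᵇ i))))
      ≡⟨ sumL-*ˡ (subsets t) (χ (isIndependent adj S)) _ ⟩
    χ (isIndependent adj S) * (∑[ T ∈ subsets t ] (χ (T ⊆ᵇ free S) * χ (∣ S ∣ ℕ.+ ∣ T ∣ ≡ᵇ i)))
      ≡⟨ cong (χ (isIndependent adj S) *_) (count-subsets-shifted (free S) ∣ S ∣ i) ⟩
    χ (isIndependent adj S) * (+ shiftedC ∣ free S ∣ ∣ S ∣ i)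
      ≡⟨ χ-guard (isIndependent adj S) (λ e →
           cong (λ m → + shiftedC m ∣ S ∣ i) (free-size′ S (isIndependent-sound adj S e))) ⟩
    χ (isIndependent adj S) * (+ shiftedC (t ∸ ∣ S ∣) ∣ S ∣ i)
      ∎
    where
    open ≡-Reasoning
    split : ∀ T → χ (isIndependent Gπ (S ++ T)) * χ (∣ S ++ T ∣ ≡ᵇ i)
                ≡ χ (isIndependent adj S) * (χ (T ⊆ᵇ free S) * χ (∣ S ∣ ℕ.+ ∣ T ∣ ≡ᵇ i))
    split T = begin
      χ (isIndependent Gπ (S ++ T)) * χ (∣ S ++ T ∣ ≡ᵇ i)
        ≡⟨ cong₂ (λ b m → χ b * χ (m ≡ᵇ i)) (independent-++ S T) (∣++∣ S T) ⟩
      χ (isIndependent adj S ∧ (T ⊆ᵇ free S)) * χ (∣ S ∣ ℕ.+ ∣ T ∣ ≡ᵇ i)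
        ≡⟨ cong (_* χ (∣ S ∣ ℕ.+ ∣ T ∣ ≡ᵇ i)) (χ-∧ (isIndependent adj S) (T ⊆ᵇ free S)) ⟩
      χ (isIndependent adj S) * χ (T ⊆ᵇ free S) * χ (∣ S ∣ ℕ.+ ∣ T ∣ ≡ᵇ i)
        ≡⟨ ℤP.*-assoc (χ (isIndependent adj S)) _ _ ⟩
      χ (isIndependent adj S) * (χ (T ⊆ᵇ free S) * χ (∣ S ∣ ℕ.+ ∣ T ∣ ≡ᵇ i))
        ∎

  numFaces-Gπ : ∀ i →
    + numFaces Gπ i ≡ ∑[ S ∈ subsets n ] (χ (isIndependent adj S) * + shiftedC (t ∸ ∣ S ∣) ∣ S ∣ i)
  numFaces-Gπ i =
    trans (numFaces≡sum Gπ i) (trans (sum-subsets-++ n t _) (sumL-cong (subsets n) (λ S → faces-over S i)))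

  face-size≤t : ∀ X → isIndependent Gπ X ≡ true → ∣ X ∣ ≤ t
  face-size≤t X e = subst (λ Y → ∣ Y ∣ ≤ t) (VecP.take++drop≡id n X)
    (bound (Vec.take n X) (Vec.drop n X) (subst (λ Y → isIndependent Gπ Y ≡ true) (sym (VecP.take++drop≡id n X)) e))
    where
    bound : ∀ S T → isIndependent Gπ (S ++ T) ≡ true → ∣ S ++ T ∣ ≤ t
    bound S T e′ = begin
      ∣ S ++ T ∣             ≡⟨ ∣++∣ S T ⟩
      ∣ S ∣ ℕ.+ ∣ T ∣         ≤⟨ ℕP.+-monoʳ-≤ ∣ S ∣ (⊆ᵇ-∣∣-mono T (free S) (BoolP.∧-conicalʳ (isIndependent adj S) _ e″)) ⟩
      ∣ S ∣ ℕ.+ ∣ free S ∣    ≡⟨ ℕP.+-comm ∣ S ∣ _ ⟩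
      ∣ free S ∣ ℕ.+ ∣ S ∣    ≡⟨ free-size S (isIndependent-sound adj S (BoolP.∧-conicalˡ _ _ e″)) ⟩
      t                      ∎
      where
      open ℕP.≤-Reasoning
      e″ : isIndependent adj S ∧ (T ⊆ᵇ free S) ≡ true
      e″ = trans (sym (independent-++ S T)) e′

  noVertices : Subset n
  noVertices = ⊥

  allWhiskers : Subset t
  allWhiskers = ⊤

  whiskers-independent : isIndependent Gπ (noVertices ++ allWhiskers) ≡ true
  whiskers-independent = begin
    isIndependent Gπ (noVertices ++ allWhiskers)               ≡⟨ independent-++ noVertices allWhiskers ⟩
    isIndependent adj noVertices ∧ (allWhiskers ⊆ᵇ free noVertices)     ≡⟨ cong₂ _∧_ (∅-independent adj) all-free ⟩
    true                                    ∎
    where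
    open ≡-Reasoning
    all-free : allWhiskers ⊆ᵇ free noVertices ≡ true
    all-free = ⊆ᵇ-complete allWhiskers (free noVertices) (λ i _ → free-complete noVertices i (λ u e →
      ⊥-elim (BoolP.not-¬ {false} refl (trans (sym (VecP.lookup-replicate u false)) e))))

  dim-Gπ : dimPlus1 Gπ ≡ t
  dim-Gπ = ℕP.≤-antisym upper lower
    where
    upper : dimPlus1 Gπ ≤ t
    upper with largest-face Gπ
    ... | X , X-ind , X-size = subst (_≤ t) X-size (face-size≤t X X-ind)
    lower : t ≤ dimPlus1 Gπ
    lower = subst (_≤ dimPlus1 Gπ) (trans (∣++∣ noVertices allWhiskers) (cong₂ ℕ._+_ (∣⊥∣≡0 n) (∣⊤∣≡n t)))
              (face-size≤dim Gπ (noVertices ++ allWhiskers) whiskers-independent)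

binomial-factorials : ∀ n k → k ≤ n → (n C k) ℕ.* (k ! ℕ.* (n ∸ k) !) ≡ n !
binomial-factorials n k k≤n = trans (cong (ℕ._* (k ! ℕ.* (n ∸ k) !)) (nCk≡n!/k![n-k]! k≤n))
  (m/n*n≡m {{ℕP._!*_!≢0 k (n ∸ k)}} (k![n∸k]!∣n! k≤n))

binomial-factorials-+ : ∀ a b → ((a ℕ.+ b) C a) ℕ.* (a ! ℕ.* b !) ≡ (a ℕ.+ b) !
binomial-factorials-+ a b = subst (λ x → ((a ℕ.+ b) C a) ℕ.* (a ! ℕ.* x !) ≡ (a ℕ.+ b) !)
  (ℕP.m+n∸m≡n a b) (binomial-factorials (a ℕ.+ b) a (ℕP.m≤m+n a b))

-- Choosing a, then c more out of the remaining c + r, is choosing a + c and then a inside it: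
-- both sides times a! c! r! equal (a + c + r)!.
choose-twice-+ : ∀ a c r →
  ((a ℕ.+ (c ℕ.+ r)) C a) ℕ.* ((c ℕ.+ r) C c) ≡ (((a ℕ.+ c) ℕ.+ r) C (a ℕ.+ c)) ℕ.* ((a ℕ.+ c) C a)
choose-twice-+ a c r = ℕP.*-cancelʳ-≡ _ _ (a ! ℕ.* (c ! ℕ.* r !)) {{nonzero}} (trans lhs (sym rhs))
  where
  nonzero : ℕ.NonZero (a ! ℕ.* (c ! ℕ.* r !))
  nonzero = ℕP.m*n≢0 _ _ {{ℕP._!≢0 a}} {{ℕP._!*_!≢0 c r}}
  X Y U V : ℕ
  X = (a ℕ.+ (c ℕ.+ r)) C a
  Y = (c ℕ.+ r) C c
  U = ((a ℕ.+ c) ℕ.+ r) C (a ℕ.+ c)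
  V = (a ℕ.+ c) C a
  lhs : X ℕ.* Y ℕ.* (a ! ℕ.* (c ! ℕ.* r !)) ≡ (a ℕ.+ (c ℕ.+ r)) !
  lhs = begin
    X ℕ.* Y ℕ.* (a ! ℕ.* (c ! ℕ.* r !))      ≡⟨ regroup X Y (a !) (c !) (r !) ⟩
    X ℕ.* (a ! ℕ.* (Y ℕ.* (c ! ℕ.* r !)))    ≡⟨ cong (λ z → X ℕ.* (a ! ℕ.* z)) (binomial-factorials-+ c r) ⟩
    X ℕ.* (a ! ℕ.* (c ℕ.+ r) !)              ≡⟨ binomial-factorials-+ a (c ℕ.+ r) ⟩
    (a ℕ.+ (c ℕ.+ r)) !                      ∎
    where
    open ≡-Reasoning
    regroup : ∀ x y p q s → x ℕ.* y ℕ.* (p ℕ.* (q ℕ.* s)) ≡ x ℕ.* (p ℕ.* (y ℕ.* (q ℕ.* s)))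
    regroup = ℕSolver.solve-∀
  rhs : U ℕ.* V ℕ.* (a ! ℕ.* (c ! ℕ.* r !)) ≡ (a ℕ.+ (c ℕ.+ r)) !
  rhs = begin
    U ℕ.* V ℕ.* (a ! ℕ.* (c ! ℕ.* r !))      ≡⟨ regroup U V (a !) (c !) (r !) ⟩
    U ℕ.* ((V ℕ.* (a ! ℕ.* c !)) ℕ.* r !)    ≡⟨ cong (λ z → U ℕ.* (z ℕ.* r !)) (binomial-factorials-+ a c) ⟩
    U ℕ.* ((a ℕ.+ c) ! ℕ.* r !)              ≡⟨ binomial-factorials-+ (a ℕ.+ c) r ⟩
    ((a ℕ.+ c) ℕ.+ r) !                      ≡⟨ cong _! (ℕP.+-assoc a c r) ⟩
    (a ℕ.+ (c ℕ.+ r)) !                      ∎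
    where
    open ≡-Reasoning
    regroup : ∀ x y p q s → x ℕ.* y ℕ.* (p ℕ.* (q ℕ.* s)) ≡ x ℕ.* ((y ℕ.* (p ℕ.* q)) ℕ.* s)
    regroup = ℕSolver.solve-∀

choose-twice : ∀ a b m → a ≤ b → b ≤ m → ((m ∸ a) C (b ∸ a)) ℕ.* (m C a) ≡ (m C b) ℕ.* (b C a)
choose-twice a b m a≤b b≤m = go (b ∸ a) (m ∸ b) (sym (ℕP.m+[n∸m]≡n a≤b)) (sym (ℕP.m+[n∸m]≡n b≤m))
  where
  go : ∀ c r → b ≡ a ℕ.+ c → m ≡ b ℕ.+ r → ((m ∸ a) C (b ∸ a)) ℕ.* (m C a) ≡ (m C b) ℕ.* (b C a)
  go c r refl refl = begin
    ((a ℕ.+ c ℕ.+ r ∸ a) C (a ℕ.+ c ∸ a)) ℕ.* ((a ℕ.+ c ℕ.+ r) C a)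
      ≡⟨ cong₂ (λ x y → (x C y) ℕ.* ((a ℕ.+ c ℕ.+ r) C a)) a+c+r∸a (ℕP.m+n∸m≡n a c) ⟩
    ((c ℕ.+ r) C c) ℕ.* ((a ℕ.+ c ℕ.+ r) C a)
      ≡⟨ cong (λ z → ((c ℕ.+ r) C c) ℕ.* (z C a)) (ℕP.+-assoc a c r) ⟩
    ((c ℕ.+ r) C c) ℕ.* ((a ℕ.+ (c ℕ.+ r)) C a)
      ≡⟨ ℕP.*-comm ((c ℕ.+ r) C c) _ ⟩
    ((a ℕ.+ (c ℕ.+ r)) C a) ℕ.* ((c ℕ.+ r) C c)
      ≡⟨ choose-twice-+ a c r ⟩
    ((a ℕ.+ c ℕ.+ r) C (a ℕ.+ c)) ℕ.* ((a ℕ.+ c) C a)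
      ∎
    where
    open ≡-Reasoning
    a+c+r∸a : a ℕ.+ c ℕ.+ r ∸ a ≡ c ℕ.+ r
    a+c+r∸a = trans (cong (_∸ a) (ℕP.+-assoc a c r)) (ℕP.m+n∸m≡n a (c ℕ.+ r))

sign : ℕ → ℤ
sign k = -[1+ 0 ] ℤ.^ k

sign-suc : ∀ k → sign (suc k) ≡ - sign k
sign-suc k = ℤP.-1*i≡-i (sign k)

sign-square : ∀ a → sign a * sign a ≡ + 1
sign-square zero    = refl
sign-square (suc a) = trans (cong₂ _*_ (sign-suc a) (sign-suc a)) (trans (neg-square (sign a)) (sign-square a))
  where
  neg-square : ∀ x → (- x) * (- x) ≡ x * x
  neg-square = ℤSolver.solve-∀

sign-∸ : ∀ a b → a ≤ b → sign (b ∸ a) ≡ sign b * sign a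
sign-∸ a b a≤b = begin
  sign (b ∸ a)                          ≡⟨ sym (ℤP.*-identityʳ _) ⟩
  sign (b ∸ a) * + 1                    ≡⟨ cong (sign (b ∸ a) *_) (sym (sign-square a)) ⟩
  sign (b ∸ a) * (sign a * sign a)      ≡⟨ sym (ℤP.*-assoc (sign (b ∸ a)) (sign a) (sign a)) ⟩
  sign (b ∸ a) * sign a * sign a        ≡⟨ cong (_* sign a) (sym (ℤP.^-distribˡ-+-* -[1+ 0 ] (b ∸ a) a)) ⟩
  sign (b ∸ a ℕ.+ a) * sign a           ≡⟨ cong (λ k → sign k * sign a) (ℕP.m∸n+n≡m a≤b) ⟩
  sign b * sign a                       ∎
  where open ≡-Reasoning

signed-pascal : ∀ b a → sign (suc a) * + (suc b C suc a) ≡ - (sign a * + (b C a)) + - (sign a * + (b C suc a))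
signed-pascal b a = begin
  sign (suc a) * + (suc b C suc a)                   ≡⟨ cong (sign (suc a) *_) (cong +_ (sym (nCk+nC[k+1]≡[n+1]C[k+1] b a))) ⟩
  sign (suc a) * + (b C a ℕ.+ b C suc a)             ≡⟨ cong₂ _*_ (sign-suc a) (ℤP.pos-+ (b C a) (b C suc a)) ⟩
  - sign a * (+ (b C a) + + (b C suc a))             ≡⟨ distrib (sign a) (+ (b C a)) (+ (b C suc a)) ⟩
  - (sign a * + (b C a)) + - (sign a * + (b C suc a)) ∎
  where
  open ≡-Reasoning
  distrib : ∀ s x y → (- s) * (x + y) ≡ - (s * x) + - (s * y)
  distrib = ℤSolver.solve-∀

-- Σ_{a ≤ b} (−1)^a C(b, a) = [b = 0].  For b + 1, Pascal's rule splits the sum into −X − Y with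
-- X = Σ_{a≤b} (−1)^a C(b, a) = 1 − Y′ and Y = Σ_{a≤b} (−1)^a C(b, a+1) = Y′, so it telescopes to 0.
alternating-binomial-sum : ∀ b → ∑[ a < suc b ] (sign a * + (b C a)) ≡ χ (b ≡ᵇ 0)
alternating-binomial-sum zero    = refl
alternating-binomial-sum (suc b) = begin
  + 1 + ∑[ a < suc b ] (sign (suc a) * + (suc b C suc a))     ≡⟨ cong (λ s → + 1 + s) pascal ⟩
  + 1 + (- X + - Y)                                           ≡⟨ cong (λ s → + 1 + (- s + - Y)) X≡1-Y′ ⟩
  + 1 + (- (+ 1 + - Y′) + - Y)                                ≡⟨ cong (λ s → + 1 + (- (+ 1 + - Y′) + - s)) Y≡Y′ ⟩
  + 1 + (- (+ 1 + - Y′) + - Y′)                               ≡⟨ cancel Y′ ⟩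
  + 0                                                         ∎
  where
  open ≡-Reasoning
  X Y Y′ : ℤ
  X  = ∑[ a < suc b ] (sign a * + (b C a))
  Y  = ∑[ a < suc b ] (sign a * + (b C suc a))
  Y′ = ∑[ a < b ] (sign a * + (b C suc a))
  pascal : ∑[ a < suc b ] (sign (suc a) * + (suc b C suc a)) ≡ - X + - Y
  pascal = trans (sumUpTo-cong (suc b) (λ a _ → signed-pascal b a))
    (trans (sumUpTo-+ (suc b) (λ a → - (sign a * + (b C a))) (λ a → - (sign a * + (b C suc a))))
      (cong₂ _+_ (sumUpTo-neg (suc b) (λ a → sign a * + (b C a))) (sumUpTo-neg (suc b) (λ a → sign a * + (b C suc a)))))
  X≡1-Y′ : X ≡ + 1 + - Y′
  X≡1-Y′ = cong (λ s → + 1 + s) (trans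
    (sumUpTo-cong b (λ a _ → trans (cong (_* + (b C suc a)) (sign-suc a)) (sym (ℤP.neg-distribˡ-* (sign a) _))))
    (sumUpTo-neg b (λ a → sign a * + (b C suc a))))
  Y≡Y′ : Y ≡ Y′
  Y≡Y′ = begin
    Y                                      ≡⟨ sumUpTo-last b (λ a → sign a * + (b C suc a)) ⟩
    Y′ + sign b * + (b C suc b)            ≡⟨ cong (λ k → Y′ + sign b * + k) (k>n⇒nCk≡0 (ℕP.n<1+n b)) ⟩
    Y′ + sign b * + 0                      ≡⟨ cong (λ s → Y′ + s) (ℤP.*-zeroʳ (sign b)) ⟩
    Y′ + + 0                               ≡⟨ ℤP.+-identityʳ Y′ ⟩
    Y′                                     ∎
  cancel : ∀ y → + 1 + (- (+ 1 + - y) + - y) ≡ + 0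
  cancel = ℤSolver.solve-∀

alternating-binomial-sum′ : ∀ b → ∑[ a < suc b ] (sign (b ∸ a) * + (b C a)) ≡ χ (b ≡ᵇ 0)
alternating-binomial-sum′ b = begin
  ∑[ a < suc b ] (sign (b ∸ a) * + (b C a))         ≡⟨ sumUpTo-cong (suc b) (λ a a≤b → regroup a (ℕP.≤-pred a≤b)) ⟩
  ∑[ a < suc b ] (sign b * (sign a * + (b C a)))    ≡⟨ sumUpTo-*ˡ (suc b) (sign b) (λ a → sign a * + (b C a)) ⟩
  sign b * ∑[ a < suc b ] (sign a * + (b C a))      ≡⟨ cong (sign b *_) (alternating-binomial-sum b) ⟩
  sign b * χ (b ≡ᵇ 0)                               ≡⟨ sign-of-indicator b ⟩
  χ (b ≡ᵇ 0)                                        ∎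
  where
  open ≡-Reasoning
  regroup : ∀ a → a ≤ b → sign (b ∸ a) * + (b C a) ≡ sign b * (sign a * + (b C a))
  regroup a a≤b = trans (cong (_* + (b C a)) (sign-∸ a b a≤b)) (ℤP.*-assoc (sign b) (sign a) _)
  sign-of-indicator : ∀ b → sign b * χ (b ≡ᵇ 0) ≡ χ (b ≡ᵇ 0)
  sign-of-indicator zero    = refl
  sign-of-indicator (suc b) = ℤP.*-zeroʳ (sign (suc b))

-- The summand of h_j(G^π) indexed by a face size s of G is
--   Σ_{i ≤ j} (−1)^{j−i} C(t−i, j−i) C(t−s, i−s)  =  [s = j]      (s, j ≤ t),
-- because C(t−i, j−i) C(t−s, i−s) = C(t−s, j−s) C(j−s, i−s) and the alternating sum of the
-- row j − s of Pascal's triangle is [j = s].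

inversionTerm : ℕ → ℕ → ℕ → ℕ → ℤ
inversionTerm t s j i = sign (j ∸ i) * + ((t ∸ i) C (j ∸ i)) * + shiftedC (t ∸ s) s i

≡ᵇ-+ : ∀ s b → (s ≡ᵇ s ℕ.+ b) ≡ (b ≡ᵇ 0)
≡ᵇ-+ zero    zero    = refl
≡ᵇ-+ zero    (suc b) = refl
≡ᵇ-+ (suc s) b       = ≡ᵇ-+ s b

-- terms with i < s vanish, since then C(t − s, i − s) is read as 0
inversionTerm-below : ∀ t s j i → i < s → inversionTerm t s j i ≡ + 0
inversionTerm-below t s j i i<s =
  trans (cong (λ k → sign (j ∸ i) * + ((t ∸ i) C (j ∸ i)) * + k) (shiftedC-< (t ∸ s) s i i<s))
        (ℤP.*-zeroʳ (sign (j ∸ i) * + ((t ∸ i) C (j ∸ i))))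

inversionTerm-shifted : ∀ s b m a → a ≤ b → b ≤ m →
  inversionTerm (s ℕ.+ m) s (s ℕ.+ b) (s ℕ.+ a) ≡ + (m C b) * (sign (b ∸ a) * + (b C a))
inversionTerm-shifted s b m a a≤b b≤m = begin
  inversionTerm (s ℕ.+ m) s (s ℕ.+ b) (s ℕ.+ a)
    ≡⟨ cong₂ (λ x y → sign x * + (y C x) * + shiftedC (s ℕ.+ m ∸ s) s (s ℕ.+ a))
         (ℕP.[m+n]∸[m+o]≡n∸o s b a) (ℕP.[m+n]∸[m+o]≡n∸o s m a) ⟩
  sign (b ∸ a) * + ((m ∸ a) C (b ∸ a)) * + shiftedC (s ℕ.+ m ∸ s) s (s ℕ.+ a)
    ≡⟨ cong (λ k → sign (b ∸ a) * + ((m ∸ a) C (b ∸ a)) * + k)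
         (trans (shiftedC-+ (s ℕ.+ m ∸ s) s a) (cong (_C a) (ℕP.m+n∸m≡n s m))) ⟩
  sign (b ∸ a) * + ((m ∸ a) C (b ∸ a)) * + (m C a)
    ≡⟨ ℤP.*-assoc (sign (b ∸ a)) _ _ ⟩
  sign (b ∸ a) * (+ ((m ∸ a) C (b ∸ a)) * + (m C a))
    ≡⟨ cong (sign (b ∸ a) *_) (sym (ℤP.pos-* ((m ∸ a) C (b ∸ a)) (m C a))) ⟩
  sign (b ∸ a) * + (((m ∸ a) C (b ∸ a)) ℕ.* (m C a))
    ≡⟨ cong (λ k → sign (b ∸ a) * + k) (choose-twice a b m a≤b b≤m) ⟩
  sign (b ∸ a) * + ((m C b) ℕ.* (b C a))
    ≡⟨ cong (sign (b ∸ a) *_) (ℤP.pos-* (m C b) (b C a)) ⟩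
  sign (b ∸ a) * (+ (m C b) * + (b C a))
    ≡⟨ swap (sign (b ∸ a)) (+ (m C b)) (+ (b C a)) ⟩
  + (m C b) * (sign (b ∸ a) * + (b C a))
    ∎
  where
  open ≡-Reasoning
  swap : ∀ x y z → x * (y * z) ≡ y * (x * z)
  swap = ℤSolver.solve-∀

binomial-inversion-+ : ∀ s b m → b ≤ m →
  ∑[ i < suc (s ℕ.+ b) ] inversionTerm (s ℕ.+ m) s (s ℕ.+ b) i ≡ χ (s ≡ᵇ s ℕ.+ b)
binomial-inversion-+ s b m b≤m = begin
  ∑[ i < suc (s ℕ.+ b) ] term i
    ≡⟨ cong (λ k → sumUpTo k term) (sym (ℕP.+-suc s b)) ⟩
  ∑[ i < s ℕ.+ suc b ] term i
    ≡⟨ sumUpTo-split s (suc b) term ⟩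
  ∑[ i < s ] term i + ∑[ a < suc b ] term (s ℕ.+ a)
    ≡⟨ cong₂ _+_ (sumUpTo-zero s (inversionTerm-below (s ℕ.+ m) s (s ℕ.+ b)))
                 (sumUpTo-cong (suc b) (λ a a≤b → inversionTerm-shifted s b m a (ℕP.≤-pred a≤b) b≤m)) ⟩
  + 0 + ∑[ a < suc b ] (+ (m C b) * (sign (b ∸ a) * + (b C a)))
    ≡⟨ ℤP.+-identityˡ _ ⟩
  ∑[ a < suc b ] (+ (m C b) * (sign (b ∸ a) * + (b C a)))
    ≡⟨ sumUpTo-*ˡ (suc b) (+ (m C b)) (λ a → sign (b ∸ a) * + (b C a)) ⟩
  + (m C b) * ∑[ a < suc b ] (sign (b ∸ a) * + (b C a))
    ≡⟨ cong (+ (m C b) *_) (alternating-binomial-sum′ b) ⟩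
  + (m C b) * χ (b ≡ᵇ 0)
    ≡⟨ only-b≡0 b ⟩
  χ (b ≡ᵇ 0)
    ≡⟨ cong χ (sym (≡ᵇ-+ s b)) ⟩
  χ (s ≡ᵇ s ℕ.+ b)
    ∎
  where
  open ≡-Reasoning
  term : ℕ → ℤ
  term = inversionTerm (s ℕ.+ m) s (s ℕ.+ b)
  only-b≡0 : ∀ b → + (m C b) * χ (b ≡ᵇ 0) ≡ χ (b ≡ᵇ 0)
  only-b≡0 zero    = refl
  only-b≡0 (suc b) = ℤP.*-zeroʳ (+ (m C suc b))

binomial-inversion : ∀ t s j → s ≤ t → j ≤ t → ∑[ i < suc j ] inversionTerm t s j i ≡ χ (s ≡ᵇ j)
binomial-inversion t s j s≤t j≤t with s ℕ.≤? j
... | yes s≤j = shift (t ∸ s) (j ∸ s) (sym (ℕP.m+[n∸m]≡n s≤t)) (sym (ℕP.m+[n∸m]≡n s≤j)) (ℕP.∸-monoˡ-≤ s j≤t)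
  where
  shift : ∀ m b → t ≡ s ℕ.+ m → j ≡ s ℕ.+ b → b ≤ m → ∑[ i < suc j ] inversionTerm t s j i ≡ χ (s ≡ᵇ j)
  shift m b refl refl b≤m = binomial-inversion-+ s b m b≤m
... | no  s≰j = trans
  (sumUpTo-zero (suc j) (λ i i≤j → inversionTerm-below t s j i (ℕP.<-≤-trans (s≤s (ℕP.≤-pred i≤j)) (ℕP.≰⇒> s≰j))))
  (cong χ (sym (dec-false (s ℕ.≟ j) (λ s≡j → s≰j (ℕP.≤-reflexive s≡j)))))

stripCons : ℤ → List ℤ → List ℤ
stripCons x []       = if ⌊ x ℤ.≟ + 0 ⌋ then [] else x ∷ []
stripCons x (y ∷ ys) = x ∷ y ∷ ys

stripZeros-∷ : ∀ x xs → stripZeros (x ∷ xs) ≡ stripCons x (stripZeros xs)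
stripZeros-∷ x xs with stripZeros xs
... | []     = refl
... | y ∷ ys = refl

stripZeros-++-zeros : ∀ xs ys → stripZeros ys ≡ [] → stripZeros (xs List.++ ys) ≡ stripZeros xs
stripZeros-++-zeros []       ys e = e
stripZeros-++-zeros (x ∷ xs) ys e = begin
  stripZeros (x ∷ xs List.++ ys)          ≡⟨ stripZeros-∷ x (xs List.++ ys) ⟩
  stripCons x (stripZeros (xs List.++ ys)) ≡⟨ cong (stripCons x) (stripZeros-++-zeros xs ys e) ⟩
  stripCons x (stripZeros xs)              ≡⟨ sym (stripZeros-∷ x xs) ⟩
  stripZeros (x ∷ xs)                      ∎
  where open ≡-Reasoning

stripZeros-zeros : ∀ k → stripZeros (applyUpTo (λ _ → + 0) k) ≡ []
stripZeros-zeros zero    = refl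
stripZeros-zeros (suc k) =
  trans (stripZeros-∷ (+ 0) (applyUpTo (λ _ → + 0) k)) (cong (stripCons (+ 0)) (stripZeros-zeros k))

stripZeros-∷ʳ : ∀ xs y → y ≢ + 0 → stripZeros (xs List.∷ʳ y) ≡ xs List.∷ʳ y
stripZeros-∷ʳ []       y y≢0 with y ℤ.≟ + 0
... | yes y≡0 = ⊥-elim (y≢0 y≡0)
... | no  _   = refl
stripZeros-∷ʳ (x ∷ xs) y y≢0 =
  trans (stripZeros-∷ x (xs List.∷ʳ y)) (trans (cong (stripCons x) (stripZeros-∷ʳ xs y y≢0)) (nonempty xs))
  where
  nonempty : ∀ zs → stripCons x (zs List.∷ʳ y) ≡ x ∷ zs List.∷ʳ y
  nonempty []       = refl
  nonempty (z ∷ zs) = refl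

applyUpTo-cong : ∀ {A : Set} n {f g : ℕ → A} → (∀ i → i < n → f i ≡ g i) → applyUpTo f n ≡ applyUpTo g n
applyUpTo-cong zero    e = refl
applyUpTo-cong (suc n) e = cong₂ _∷_ (e 0 (s≤s z≤n)) (applyUpTo-cong n (λ i i<n → e (suc i) (s≤s i<n)))

applyUpTo-+ : ∀ {A : Set} (f : ℕ → A) m k → applyUpTo f (m ℕ.+ k) ≡ applyUpTo f m List.++ applyUpTo (λ i → f (m ℕ.+ i)) k
applyUpTo-+ f zero    k = refl
applyUpTo-+ f (suc m) k = cong (f 0 ∷_) (applyUpTo-+ (f ∘ suc) m k)

stripZeros-face-numbers : ∀ {n} (adj : Adj n) d → dimPlus1 adj ≤ d →
  stripZeros (applyUpTo (λ k → + numFaces adj k) (suc d)) ≡ map (λ x → + x) (faceVector adj)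
stripZeros-face-numbers adj d dim≤d = begin
  stripZeros (applyUpTo f (suc d))
    ≡⟨ cong (λ k → stripZeros (applyUpTo f (suc k))) (sym (ℕP.m+[n∸m]≡n dim≤d)) ⟩
  stripZeros (applyUpTo f (suc dim ℕ.+ (d ∸ dim)))
    ≡⟨ cong stripZeros (applyUpTo-+ f (suc dim) (d ∸ dim)) ⟩
  stripZeros (applyUpTo f (suc dim) List.++ applyUpTo (λ i → f (suc dim ℕ.+ i)) (d ∸ dim))
    ≡⟨ stripZeros-++-zeros (applyUpTo f (suc dim)) _ tail-zero ⟩
  stripZeros (applyUpTo f (suc dim))
    ≡⟨ cong stripZeros (sym (ListP.applyUpTo-∷ʳ f dim)) ⟩
  stripZeros (applyUpTo f dim List.∷ʳ f dim)
    ≡⟨ stripZeros-∷ʳ (applyUpTo f dim) (f dim) (λ e → numFaces-top≢0 adj (ℤP.+-injective e)) ⟩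
  applyUpTo f dim List.∷ʳ f dim
    ≡⟨ ListP.applyUpTo-∷ʳ f dim ⟩
  applyUpTo f (suc dim)
    ≡⟨ sym (ListP.map-applyUpTo (numFaces adj) (λ x → + x) (suc dim)) ⟩
  map (λ x → + x) (applyUpTo (numFaces adj) (suc dim))
    ≡⟨ cong (map (λ x → + x)) (sym (ListP.map-applyUpTo (λ i → i) (numFaces adj) (suc dim))) ⟩
  map (λ x → + x) (faceVector adj)
    ∎
  where
  open ≡-Reasoning
  f : ℕ → ℤ
  f k = + numFaces adj k
  dim : ℕ
  dim = dimPlus1 adj
  tail-zero : stripZeros (applyUpTo (λ i → f (suc dim ℕ.+ i)) (d ∸ dim)) ≡ []
  tail-zero = trans (cong stripZeros (applyUpTo-cong (d ∸ dim)
      (λ i _ → cong +_ (numFaces-above-dim adj (suc dim ℕ.+ i) (s≤s (ℕP.m≤m+n dim i))))))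
    (stripZeros-zeros (d ∸ dim))

module WhiskeredHVector {n t : ℕ} (adj : Adj n) (π : Vec (Subset n) t) (cp : IsCliqueVertexPartition adj π) where
  open Whiskered adj π
  open CliquePartition adj π cp

  independent-size≤t : ∀ S → isIndependent adj S ≡ true → ∣ S ∣ ≤ t
  independent-size≤t S e = subst (∣ S ∣ ≤_) (free-size S (isIndependent-sound adj S e)) (ℕP.m≤n+m ∣ S ∣ _)

  dim≤t : dimPlus1 adj ≤ t
  dim≤t with largest-face adj
  ... | S , S-ind , S-size = subst (_≤ t) S-size (independent-size≤t S S-ind)

  coef : ℕ → ℕ → ℤ
  coef j i = sign (j ∸ i) * + ((dimPlus1 Gπ ∸ i) C (j ∸ i))

  term : Subset n → ℕ → ℤ
  term S i = χ (isIndependent adj S) * + shiftedC (t ∸ ∣ S ∣) ∣ S ∣ i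

  contribution : ∀ j → j ≤ t → ∀ S →
    ∑[ i ∈ upTo (suc j) ] (coef j i * term S i) ≡ χ (isIndependent adj S) * χ (∣ S ∣ ≡ᵇ j)
  contribution j j≤t S = begin
    (∑[ i ∈ upTo (suc j) ] (coef j i * term S i))
      ≡⟨ sumL-cong (upTo (suc j)) (λ i → swap (coef j i) (χ (isIndependent adj S)) _) ⟩
    (∑[ i ∈ upTo (suc j) ] (χ (isIndependent adj S) * (coef j i * + shiftedC (t ∸ ∣ S ∣) ∣ S ∣ i)))
      ≡⟨ sumL-*ˡ (upTo (suc j)) (χ (isIndependent adj S)) _ ⟩
    χ (isIndependent adj S) * (∑[ i ∈ upTo (suc j) ] (coef j i * + shiftedC (t ∸ ∣ S ∣) ∣ S ∣ i))
      ≡⟨ cong (χ (isIndependent adj S) *_) (sumL-upTo (suc j) (λ i → coef j i * + shiftedC (t ∸ ∣ S ∣) ∣ S ∣ i)) ⟩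
    χ (isIndependent adj S) * (∑[ i < suc j ] (coef j i * + shiftedC (t ∸ ∣ S ∣) ∣ S ∣ i))
      ≡⟨ cong (λ d → χ (isIndependent adj S) * (∑[ i < suc j ] (sign (j ∸ i) * + ((d ∸ i) C (j ∸ i))
                 * + shiftedC (t ∸ ∣ S ∣) ∣ S ∣ i))) dim-Gπ ⟩
    χ (isIndependent adj S) * (∑[ i < suc j ] inversionTerm t ∣ S ∣ j i)
      ≡⟨ χ-guard (isIndependent adj S) (λ e → binomial-inversion t ∣ S ∣ j (independent-size≤t S e) j≤t) ⟩
    χ (isIndependent adj S) * χ (∣ S ∣ ≡ᵇ j)
      ∎
    where
    open ≡-Reasoning
    swap : ∀ x y z → x * (y * z) ≡ y * (x * z)
    swap = ℤSolver.solve-∀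

  hEntry-Gπ : ∀ j → j ≤ t → hEntry Gπ j ≡ + numFaces adj j
  hEntry-Gπ j j≤t = begin
    hEntry Gπ j
      ≡⟨ foldr-map≡sumL (upTo (suc j)) (λ i → coef j i * + numFaces Gπ i) ⟩
    (∑[ i ∈ upTo (suc j) ] (coef j i * + numFaces Gπ i))
      ≡⟨ sumL-cong (upTo (suc j)) (λ i → cong (coef j i *_) (numFaces-Gπ i)) ⟩
    (∑[ i ∈ upTo (suc j) ] (coef j i * ∑[ S ∈ subsets n ] term S i))
      ≡⟨ sumL-cong (upTo (suc j)) (λ i → sym (sumL-*ˡ (subsets n) (coef j i) (λ S → term S i))) ⟩
    (∑[ i ∈ upTo (suc j) ] ∑[ S ∈ subsets n ] (coef j i * term S i))
      ≡⟨ sumL-swap (upTo (suc j)) (subsets n) (λ i S → coef j i * term S i) ⟩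
    (∑[ S ∈ subsets n ] ∑[ i ∈ upTo (suc j) ] (coef j i * term S i))
      ≡⟨ sumL-cong (subsets n) (contribution j j≤t) ⟩
    (∑[ S ∈ subsets n ] (χ (isIndependent adj S) * χ (∣ S ∣ ≡ᵇ j)))
      ≡⟨ sym (numFaces≡sum adj j) ⟩
    + numFaces adj j
      ∎
    where open ≡-Reasoning

  hVector-Gπ : hVector Gπ ≡ applyUpTo (λ j → + numFaces adj j) (suc t)
  hVector-Gπ = begin
    map (hEntry Gπ) (upTo (suc (dimPlus1 Gπ)))       ≡⟨ cong (λ d → map (hEntry Gπ) (upTo (suc d))) dim-Gπ ⟩
    map (hEntry Gπ) (upTo (suc t))                   ≡⟨ ListP.map-applyUpTo (λ i → i) (hEntry Gπ) (suc t) ⟩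
    applyUpTo (hEntry Gπ) (suc t)                    ≡⟨ applyUpTo-cong (suc t) (λ j j<1+t → hEntry-Gπ j (ℕP.≤-pred j<1+t)) ⟩
    applyUpTo (λ j → + numFaces adj j) (suc t)       ∎
    where open ≡-Reasoning

  stripped-hVector-Gπ : stripZeros (hVector Gπ) ≡ map (λ x → + x) (faceVector adj)
  stripped-hVector-Gπ = trans (cong stripZeros hVector-Gπ) (stripZeros-face-numbers adj t dim≤t)

trivial-cliquePartition : ∀ {n} (adj : Adj n) → IsCliqueVertexPartition adj (trivialPartition n)
trivial-cliquePartition {n} adj = cliques , disjoint , covering
  where
  part≡⁅⁆ : ∀ i → lookup (trivialPartition n) i ≡ ⁅ i ⁆
  part≡⁅⁆ i = VecP.lookup∘tabulate ⁅_⁆ i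
  member : ∀ i u → lookup (lookup (trivialPartition n) i) u ≡ true → u ≡ i
  member i u e = x∈⁅y⁆⇒x≡y i (VecP.lookup⇒[]= u ⁅ i ⁆ (trans (cong (λ W → lookup W u) (sym (part≡⁅⁆ i))) e))
  cliques : ∀ i → IsClique adj (lookup (trivialPartition n) i)
  cliques i u v eu ev u≢v = ⊥-elim (u≢v (trans (member i u eu) (sym (member i v ev))))
  disjoint : ∀ i j → i ≢ j → lookup (trivialPartition n) i ∩ lookup (trivialPartition n) j ≡ ⊥
  disjoint i j i≢j = trans (cong₂ _∩_ (part≡⁅⁆ i) (part≡⁅⁆ j)) (Empty-unique λ (x , x∈) →
    let x∈⁅i⁆ , x∈⁅j⁆ = x∈p∩q⁻ ⁅ i ⁆ ⁅ j ⁆ x∈ in i≢j (trans (sym (x∈⁅y⁆⇒x≡y i x∈⁅i⁆)) (x∈⁅y⁆⇒x≡y j x∈⁅j⁆)))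
  covering : ∀ v → Σ (Fin n) λ i → lookup (lookup (trivialPartition n) i) v ≡ true
  covering v = v , trans (cong (λ W → lookup W v) (part≡⁅⁆ v)) (VecP.[]=⇒lookup (x∈⁅x⁆ v))

-- (1) ⇒ (3) ⇒ (2): whisker fully, which is whiskering along the trivial partition.
-- (2) ⇒ (1): the trimmed h-vector of G^π is the face vector of Ind G, and +_ : ℕ → ℤ is injective.
theorem3p9 : (f : List ℕ) → All (λ x → 0 < x) f →
    (IsFlagFaceVector f ⇔ IsCliqueWhiskeredHVector f) × (IsFlagFaceVector f ⇔ IsFullyWhiskeredHVector f)
theorem3p9 f _ = mk⇔ (fully⇒clique ∘ flag⇒fully) clique⇒flag , mk⇔ flag⇒fully (clique⇒flag ∘ fully⇒clique)
  where
  open WhiskeredHVector using (stripped-hVector-Gπ)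

  flag⇒fully : IsFlagFaceVector f → IsFullyWhiskeredHVector f
  flag⇒fully (n , adj , n>0 , simple , fv≡f) = n , adj , n>0 , simple ,
    trans (stripped-hVector-Gπ adj (trivialPartition n) (trivial-cliquePartition adj)) (cong (map (λ x → + x)) fv≡f)

  fully⇒clique : IsFullyWhiskeredHVector f → IsCliqueWhiskeredHVector f
  fully⇒clique (n , adj , n>0 , simple , h≡f) =
    n , adj , n , trivialPartition n , n>0 , simple , trivial-cliquePartition adj , h≡f

  clique⇒flag : IsCliqueWhiskeredHVector f → IsFlagFaceVector f
  clique⇒flag (n , adj , t , π , n>0 , simple , π-ok , h≡f) = n , adj , n>0 , simple ,
    ListP.map-injective ℤP.+-injective (trans (sym (stripped-hVector-Gπ adj π π-ok)) h≡f)
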